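{- Let $m<n$, let $\pi_1$ be a permutation of $[m]$ and $\pi_2$ a permutation of $\{m+1,\dotsc,n\}$, let $\mu\in(\mathbb{Z}_{\ge0})^n$ and let $\hat\sigma\in\mathrm{NAF}_\mu^{\pi_1\pi_2}$. Then $\mathrm{coinv}(f(\hat\sigma))=\mathrm{coinv}'(\hat\sigma)$.
   Context: $\pi_1\pi_2\in S_n$ is the concatenation ($i\mapsto\pi_1(i)$ for $i\le m$, $i\mapsto\pi_2(i)$ for $i>m$). For a permutation $\rho$ of $[a,b]$, $\rho^c(i)=a+b-\rho(i)$. For $\mu\in(\mathbb{Z}_{\ge0})^n$: $\mathrm{dg}'(\mu)=\{(i,j):1\le i\le n,\ 1\le j\le\mu_i\}$, $\hat{\mathrm{dg}}(\mu)=\mathrm{dg}'(\mu)\cup\{(i,0):1\le i\le n\}$. For $u=(i,j)\in\mathrm{dg}'(\mu)$: $d(u)=(i,j-1)$, and $a(u)$ is the number of $(i',j)\in\mathrm{dg}'(\mu)$ with $i'<i$, $\mu_{i'}\le\mu_i$, plus the number of $(i',j-1)\in\hat{\mathrm{dg}}(\mu)$ with $i'>i$, $\mu_{i'}<\mu_i$. An augmented filling with basement $\pi\in S_n$ is $\hat\sigma:\hat{\mathrm{dg}}(\mu)\to[n]$ with $\hat\sigma(i,0)=\pi(i)$. Distinct boxes attack if in the same row or of the form $(i,j),(i',j-1)$ with $i'>i$; $\mathrm{NAF}^\pi_\mu$ is the set of augmented fillings with basement $\pi$ with distinct values on attacking pairs. A descent is $u\in\mathrm{dg}'(\mu)$ with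 $\hat\sigma(u)>\hat\sigma(d(u))$. Reading order: rows from top to bottom, right to left within a row. An inversion is a pair of attacking boxes $u,v$ with $u$ before $v$ in reading order and $\hat\sigma(u)>\hat\sigma(v)$; $\mathrm{Inv}(\hat\sigma)$ is the set of inversions. For basement $\pi$: $\mathrm{inv}(\hat\sigma)=|\mathrm{Inv}(\hat\sigma)|-|\{i<j:\mu_i\le\mu_j,\ \pi(i)<\pi(j)\}|-\sum_{u\text{ descent}}a(u)$; $\mathrm{coinv}(\hat\sigma)=\sum_{u\in\mathrm{dg}'(\mu)}a(u)-\mathrm{inv}(\hat\sigma)$; $\mathrm{coinv}'(\hat\sigma)=\sum_{u\in\mathrm{dg}'(\mu),\ \hat\sigma(u)\ne\hat\sigma(d(u))}a(u)-\mathrm{coinv}(\hat\sigma)$. The map $f:\mathrm{NAF}_\mu^{\pi_1\pi_2}\to\mathrm{NAF}_\mu^{\pi_1^c\pi_2^c}$: $f(\hat\sigma)$ has basement $\pi_1^c\pi_2^c$ and, for $u\in\mathrm{dg}'(\mu)$, $f(\hat\sigma)(u)=m+1-\hat\sigma(u)$ if $\hat\sigma(u)\le m$, and $f(\hat\sigma)(u)=n+m+1-\hat\sigma(u)$ if $\hat\sigma(u)\ge m+1$. -}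

module Defs where

open import Data.Nat using (ℕ; zero; suc; _+_; _∸_; _≤_; _<_; _≤ᵇ_; _<ᵇ_; _≡ᵇ_)
open import Data.Bool using (Bool; true; false; _∧_; _∨_; not; if_then_else_)
open import Data.List using (List; []; _∷_; map; upTo; concatMap; filter; length; cartesianProduct)
open import Data.Nat.ListAction using (sum)
open import Data.Product using (_×_; _,_; proj₁; proj₂)
open import Data.Integer as ℤ using (ℤ; _-_)
open import Relation.Binary.PropositionalEquality using (_≡_; _≢_)
open import Relation.Nullary.Decidable using (Dec)
open import Data.Bool.Properties using (T?)
open import Data.Bool using (T)

-- Conventions: indices (columns) are 1-indexed naturals 1..n, rows are naturals
-- (row 0 = basement).  A box is a pair (i , j) = (column , row).
-- Permutations, compositions, fillings are functions ℕ → ℕ; only values on the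
-- relevant finite domain matter.

Box : Set
Box = ℕ × ℕ

range : ℕ → ℕ → List ℕ
range a b = map (λ k → a + k) (upTo (suc b ∸ a))

IsPermOn : ℕ → ℕ → (ℕ → ℕ) → Set
IsPermOn a b ρ =
  (∀ i → a ≤ i → i ≤ b → (a ≤ ρ i) × (ρ i ≤ b)) ×
  (∀ i i' → a ≤ i → i ≤ b → a ≤ i' → i' ≤ b → ρ i ≡ ρ i' → i ≡ i')

concatPerm : ℕ → (ℕ → ℕ) → (ℕ → ℕ) → ℕ → ℕ
concatPerm m π₁ π₂ i = if i ≤ᵇ m then π₁ i else π₂ i

compl : ℕ → ℕ → (ℕ → ℕ) → ℕ → ℕ
compl a b ρ i = a + b ∸ ρ i

Filling : Set
Filling = ℕ → ℕ → ℕ   -- σ i j = value in column i, row j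

inDg' : ℕ → (ℕ → ℕ) → Box → Bool
inDg' n μ (i , j) = (1 ≤ᵇ i) ∧ (i ≤ᵇ n) ∧ (1 ≤ᵇ j) ∧ (j ≤ᵇ μ i)

inHat : ℕ → (ℕ → ℕ) → Box → Bool
inHat n μ (i , j) = (1 ≤ᵇ i) ∧ (i ≤ᵇ n) ∧ (j ≤ᵇ μ i)

dgBoxes : ℕ → (ℕ → ℕ) → List Box
dgBoxes n μ = concatMap (λ i → map (λ j → (i , j)) (range 1 (μ i))) (range 1 n)

hatBoxes : ℕ → (ℕ → ℕ) → List Box
hatBoxes n μ = concatMap (λ i → map (λ j → (i , j)) (range 0 (μ i))) (range 1 n)

count : {A : Set} → (A → Bool) → List A → ℕ
count p xs = length (filter (λ x → T? (p x)) xs)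

boxEq : Box → Box → Bool
boxEq (i , j) (i' , j') = (i ≡ᵇ i') ∧ (j ≡ᵇ j')

attacks : Box → Box → Bool
attacks (i , j) (i' , j') =
  not (boxEq (i , j) (i' , j')) ∧
  ((j ≡ᵇ j') ∨ ((j ≡ᵇ suc j') ∧ (i <ᵇ i')) ∨ ((j' ≡ᵇ suc j) ∧ (i' <ᵇ i)))

before : Box → Box → Bool
before (i , j) (i' , j') = (j' <ᵇ j) ∨ ((j ≡ᵇ j') ∧ (i' <ᵇ i))

down : Box → Box
down (i , j) = (i , j ∸ 1)

val : Filling → Box → ℕ
val σ (i , j) = σ i j

IsAugFilling : ℕ → (ℕ → ℕ) → (ℕ → ℕ) → Filling → Set
IsAugFilling n μ π σ =
  (∀ i → 1 ≤ i → i ≤ n → σ i 0 ≡ π i) ×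
  (∀ u → T (inHat n μ u) → (1 ≤ val σ u) × (val σ u ≤ n))

IsNAF : ℕ → (ℕ → ℕ) → (ℕ → ℕ) → Filling → Set
IsNAF n μ π σ =
  IsAugFilling n μ π σ ×
  (∀ u v → T (inHat n μ u) → T (inHat n μ v) → T (attacks u v) → val σ u ≢ val σ v)

arm : ℕ → (ℕ → ℕ) → Box → ℕ
arm n μ (i , j) =
  count (λ i' → (i' <ᵇ i) ∧ inDg' n μ (i' , j) ∧ (μ i' ≤ᵇ μ i)) (range 1 n) +
  count (λ i' → (i <ᵇ i') ∧ inHat n μ (i' , j ∸ 1) ∧ (μ i' <ᵇ μ i)) (range 1 n)

invCount : ℕ → (ℕ → ℕ) → Filling → ℕ
invCount n μ σ =
  count (λ p → attacks (proj₁ p) (proj₂ p) ∧ before (proj₁ p) (proj₂ p)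
               ∧ (val σ (proj₂ p) <ᵇ val σ (proj₁ p)))
        (cartesianProduct (hatBoxes n μ) (hatBoxes n μ))

basementCount : ℕ → (ℕ → ℕ) → (ℕ → ℕ) → ℕ
basementCount n μ π =
  count (λ p → (proj₁ p <ᵇ proj₂ p) ∧ (μ (proj₁ p) ≤ᵇ μ (proj₂ p)) ∧ (π (proj₁ p) <ᵇ π (proj₂ p)))
        (cartesianProduct (range 1 n) (range 1 n))

isDescent : Filling → Box → Bool
isDescent σ u = val σ (down u) <ᵇ val σ u

descentArmSum : ℕ → (ℕ → ℕ) → Filling → ℕ
descentArmSum n μ σ = sum (map (arm n μ) (filter (λ u → T? (isDescent σ u)) (dgBoxes n μ)))

totalArm : ℕ → (ℕ → ℕ) → ℕ
totalArm n μ = sum (map (arm n μ) (dgBoxes n μ))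

nonEqArmSum : ℕ → (ℕ → ℕ) → Filling → ℕ
nonEqArmSum n μ σ =
  sum (map (arm n μ) (filter (λ u → T? (not (val σ u ≡ᵇ val σ (down u)))) (dgBoxes n μ)))

inv : ℕ → (ℕ → ℕ) → (ℕ → ℕ) → Filling → ℤ
inv n μ π σ = ℤ.+ invCount n μ σ - ℤ.+ basementCount n μ π - ℤ.+ descentArmSum n μ σ

coinv : ℕ → (ℕ → ℕ) → (ℕ → ℕ) → Filling → ℤ
coinv n μ π σ = ℤ.+ totalArm n μ - inv n μ π σ

coinv' : ℕ → (ℕ → ℕ) → (ℕ → ℕ) → Filling → ℤ
coinv' n μ π σ = ℤ.+ nonEqArmSum n μ σ - coinv n μ π σ

fMap : ℕ → ℕ → (ℕ → ℕ) → (ℕ → ℕ) → Filling → Filling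
fMap n m π₁ π₂ σ i zero = concatPerm m (compl 1 m π₁) (compl (m + 1) n π₂) i
fMap n m π₁ π₂ σ i (suc j) =
  if σ i (suc j) ≤ᵇ m then suc m ∸ σ i (suc j) else n + m + 1 ∸ σ i (suc j)

-- A box w in the arm of u ∈ dg'(μ) attacks both u and d(u); call (u, d(u), w) a triple.  The arm sums
-- and the descent and non-equality weights split over the triples, and every inversion outside the
-- basement row is the pair {u, w} or {w, d(u)} of exactly one triple, so
-- inv(σ) = (basement pairs) + Σ_triples ([σ w < σ u] + [σ(d u) < σ w]).
-- The value map of f is v ↦ m + 1 - v (mod n), a reflection of the cyclic order on [n]: it exchanges
-- the cyclic ascents and descents of (σ u, σ w, σ(d u)).  Hence, triple by triple,
-- 2 + [descent of σ] + [descent of f σ] = [σ u ≠ σ(d u)] + (inversions of σ) + (inversions of f σ),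
-- and summing over all triples is exactly coinv(f σ) = coinv'(σ) once the basement pairs cancel.

module Submission where

open import Defs
open import Data.Nat using (ℕ; _<_; _+_)
open import Relation.Binary.PropositionalEquality using (_≡_)

open import Data.Bool using (Bool; true; false; _∧_; not; T; if_then_else_)
open import Data.Bool.Properties using (T-≡; T-∧; T?; ∧-zeroʳ; ∧-identityʳ; ∨-identityʳ)
import Data.Bool.Properties as Bool
import Data.Integer as ℤ
import Data.Integer.Properties as ℤ
import Data.Integer.Tactic.RingSolver as ℤ-Solver
open import Data.List using (List; []; _∷_; map; applyUpTo; upTo; filter; concatMap; cartesianProduct; _++_)
open import Data.List.Properties using (map-++)
open import Data.Nat using (zero; suc; _*_; _∸_; _≤_; _<ᵇ_; _≤ᵇ_; _≡ᵇ_; z≤n; s≤s; z<s; s<s)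
open import Data.Nat.ListAction using (sum)
open import Data.Nat.ListAction.Properties using (sum-++)
open import Data.Nat.Properties
open import Algebra.Properties.CommutativeSemigroup +-commutativeSemigroup using (interchange)
open import Data.Nat.Tactic.RingSolver using (solve-∀)
open import Data.Product using (_×_; _,_; proj₁; proj₂)
import Data.Product as Product
open import Data.Sum using (_⊎_; inj₁; inj₂)
import Data.Sum as Sum
open import Data.Unit using (tt)
open import Function using (_∘_)
open import Function.Bundles using (Equivalence)
open import Relation.Binary.Definitions using (tri<; tri≈; tri>)
open import Relation.Binary.PropositionalEquality using (_≢_; refl; sym; trans; cong; cong₂; subst)
open Relation.Binary.PropositionalEquality.≡-Reasoning
open import Relation.Nullary using (yes; no; ofʸ; ofⁿ; contradiction)
open import Relation.Nullary.Decidable using (dec-true; dec-false)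

𝟙 : Bool → ℕ
𝟙 true = 1
𝟙 false = 0

𝟙-<ᵇ-swap : ∀ {a b} → a ≢ b → 𝟙 (a <ᵇ b) + 𝟙 (b <ᵇ a) ≡ 1
𝟙-<ᵇ-swap {a} {b} a≢b with <-cmp a b
... | tri< a<b _ b≮a rewrite dec-true (a <? b) a<b | dec-false (b <? a) b≮a = refl
... | tri≈ _ a≡b _ = contradiction a≡b a≢b
... | tri> a≮b _ b<a rewrite dec-false (a <? b) a≮b | dec-true (b <? a) b<a = refl

𝟙-selectˡ : ∀ {p q x y} → p ≡ true → q ≡ false → 𝟙 p * x + 𝟙 q * y ≡ x
𝟙-selectˡ {x = x} refl refl = trans (+-identityʳ _) (*-identityˡ x)

𝟙-selectʳ : ∀ {p q x y} → p ≡ false → q ≡ true → 𝟙 p * x + 𝟙 q * y ≡ y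
𝟙-selectʳ {y = y} refl refl = *-identityˡ y

∑ : ℕ → (ℕ → ℕ) → ℕ
∑ zero f = 0
∑ (suc k) f = f 0 + ∑ k (f ∘ suc)

syntax ∑ k (λ i → e) = ∑[ i < k ] e

∑-cong : ∀ k {f g : ℕ → ℕ} → (∀ i → i < k → f i ≡ g i) → ∑ k f ≡ ∑ k g
∑-cong zero eq = refl
∑-cong (suc k) eq = cong₂ _+_ (eq 0 z<s) (∑-cong k (λ i i<k → eq (suc i) (s<s i<k)))

∑-zero : ∀ k {f : ℕ → ℕ} → (∀ i → i < k → f i ≡ 0) → ∑ k f ≡ 0
∑-zero zero eq = refl
∑-zero (suc k) eq rewrite eq 0 z<s = ∑-zero k (λ i i<k → eq (suc i) (s<s i<k))

∑-distrib-+ : ∀ k (f g : ℕ → ℕ) → ∑[ i < k ] (f i + g i) ≡ ∑ k f + ∑ k g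
∑-distrib-+ zero f g = refl
∑-distrib-+ (suc k) f g =
  trans (cong (f 0 + g 0 +_) (∑-distrib-+ k (f ∘ suc) (g ∘ suc))) (interchange (f 0) (g 0) _ _)

*-distribˡ-∑ : ∀ k w (f : ℕ → ℕ) → w * ∑ k f ≡ ∑[ i < k ] (w * f i)
*-distribˡ-∑ zero w f = *-zeroʳ w
*-distribˡ-∑ (suc k) w f = trans (*-distribˡ-+ w (f 0) _) (cong (w * f 0 +_) (*-distribˡ-∑ k w (f ∘ suc)))

∑-comm : ∀ a b (f : ℕ → ℕ → ℕ) → ∑[ i < a ] ∑[ j < b ] f i j ≡ ∑[ j < b ] ∑[ i < a ] f i j
∑-comm zero b f = sym (∑-zero b (λ _ _ → refl))
∑-comm (suc a) b f = trans (cong (∑ b (f 0) +_) (∑-comm a b (f ∘ suc)))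
                           (sym (∑-distrib-+ b (f 0) (λ j → ∑[ i < a ] f (suc i) j)))

∑-δ : ∀ k j (h : ℕ → ℕ) → ∑[ b < k ] (𝟙 (b ≡ᵇ j) * h b) ≡ 𝟙 (j <ᵇ k) * h j
∑-δ zero j h = refl
∑-δ (suc k) zero h = trans (cong (h 0 + 0 +_) (∑-zero k (λ _ _ → refl))) (+-identityʳ _)
∑-δ (suc k) (suc j) h = ∑-δ k j (h ∘ suc)

∑-pad : ∀ {c d} (h : ℕ → ℕ) → c ≤ d → ∑ c h ≡ ∑[ k < d ] (𝟙 (k <ᵇ c) * h k)
∑-pad {zero} {d} h _ = sym (∑-zero d (λ _ _ → refl))
∑-pad {suc c} {suc d} h (s≤s c≤d) = cong₂ _+_ (sym (+-identityʳ (h 0))) (∑-pad (h ∘ suc) c≤d)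

pairSum : ℕ → (ℕ → ℕ → ℕ) → ℕ
pairSum n F = ∑[ i < n ] ∑[ a < n ] F (suc i) (suc a)

pairSum-cong : ∀ n (F G : ℕ → ℕ → ℕ) → (∀ i a → i < n → a < n → F (suc i) (suc a) ≡ G (suc i) (suc a)) →
  pairSum n F ≡ pairSum n G
pairSum-cong n F G eq = ∑-cong n (λ i i<n → ∑-cong n (λ a a<n → eq i a i<n a<n))

pairSum-distrib-+ : ∀ n (F G : ℕ → ℕ → ℕ) → pairSum n (λ t s → F t s + G t s) ≡ pairSum n F + pairSum n G
pairSum-distrib-+ n F G =
  trans (∑-cong n (λ i _ → ∑-distrib-+ n (F (suc i) ∘ suc) (G (suc i) ∘ suc))) (∑-distrib-+ n _ _)

pairSum-transpose : ∀ n (F : ℕ → ℕ → ℕ) → pairSum n (λ t s → F s t) ≡ pairSum n F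
pairSum-transpose n F = ∑-comm n n (λ i a → F (suc a) (suc i))

private
  variable
    A B : Set

count≡sum-𝟙 : (p : A → Bool) (xs : List A) → count p xs ≡ sum (map (𝟙 ∘ p) xs)
count≡sum-𝟙 p [] = refl
count≡sum-𝟙 p (x ∷ xs) with p x
... | true = cong suc (count≡sum-𝟙 p xs)
... | false = count≡sum-𝟙 p xs

sum-map-filter : (p : A → Bool) (f : A → ℕ) (xs : List A) →
  sum (map f (filter (T? ∘ p) xs)) ≡ sum (map (λ x → 𝟙 (p x) * f x) xs)
sum-map-filter p f [] = refl
sum-map-filter p f (x ∷ xs) with p x
... | true = cong₂ _+_ (sym (+-identityʳ (f x))) (sum-map-filter p f xs)
... | false = sum-map-filter p f xs

sum-map-cong : {f g : A → ℕ} (xs : List A) → (∀ x → f x ≡ g x) → sum (map f xs) ≡ sum (map g xs)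
sum-map-cong [] eq = refl
sum-map-cong (x ∷ xs) eq = cong₂ _+_ (eq x) (sum-map-cong xs eq)

sum-map-applyUpTo : (f : A → ℕ) (g : ℕ → A) (k : ℕ) → sum (map f (applyUpTo g k)) ≡ ∑[ i < k ] f (g i)
sum-map-applyUpTo f g zero = refl
sum-map-applyUpTo f g (suc k) = cong (f (g 0) +_) (sum-map-applyUpTo f (g ∘ suc) k)

sum-map-map : (f : B → ℕ) (h : A → B) (xs : List A) → sum (map f (map h xs)) ≡ sum (map (f ∘ h) xs)
sum-map-map f h [] = refl
sum-map-map f h (x ∷ xs) = cong (f (h x) +_) (sum-map-map f h xs)

sum-map-++ : (f : A → ℕ) (xs ys : List A) → sum (map f (xs ++ ys)) ≡ sum (map f xs) + sum (map f ys)
sum-map-++ f xs ys = trans (cong sum (map-++ f xs ys)) (sum-++ (map f xs) (map f ys))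

sum-map-concatMap : (f : B → ℕ) (g : A → List B) (xs : List A) →
  sum (map f (concatMap g xs)) ≡ sum (map (λ x → sum (map f (g x))) xs)
sum-map-concatMap f g [] = refl
sum-map-concatMap f g (x ∷ xs) =
  trans (sum-map-++ f (g x) (concatMap g xs)) (cong (sum (map f (g x)) +_) (sum-map-concatMap f g xs))

sum-map-cartesianProduct : (f : A × B → ℕ) (xs : List A) (ys : List B) →
  sum (map f (cartesianProduct xs ys)) ≡ sum (map (λ x → sum (map (λ y → f (x , y)) ys)) xs)
sum-map-cartesianProduct f [] ys = refl
sum-map-cartesianProduct f (x ∷ xs) ys =
  trans (sum-map-++ f (map (x ,_) ys) (cartesianProduct xs ys))
        (cong₂ _+_ (sum-map-map f (x ,_) ys) (sum-map-cartesianProduct f xs ys))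

sum-map-range₀ : (f : ℕ → ℕ) (b : ℕ) → sum (map f (range 0 b)) ≡ ∑[ j < suc b ] f j
sum-map-range₀ f b = trans (sum-map-map f (0 +_) (upTo (suc b))) (sum-map-applyUpTo f (λ j → j) (suc b))

sum-map-range₁ : (f : ℕ → ℕ) (n : ℕ) → sum (map f (range 1 n)) ≡ ∑[ i < n ] f (suc i)
sum-map-range₁ f n = trans (sum-map-map f (1 +_) (upTo n)) (sum-map-applyUpTo (f ∘ suc) (λ i → i) n)

sum-map-hatBoxes : ∀ n μ (F : Box → ℕ) →
  sum (map F (hatBoxes n μ)) ≡ ∑[ i < n ] ∑[ j < suc (μ (suc i)) ] F (suc i , j)
sum-map-hatBoxes n μ F =
  trans (sum-map-concatMap F (λ i → map (i ,_) (range 0 (μ i))) (range 1 n))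
  (trans (sum-map-range₁ _ n)
         (∑-cong n (λ i _ → trans (sum-map-map F (suc i ,_) (range 0 (μ (suc i))))
                                  (sum-map-range₀ (λ j → F (suc i , j)) (μ (suc i))))))

sum-map-dgBoxes : ∀ n μ (F : Box → ℕ) →
  sum (map F (dgBoxes n μ)) ≡ ∑[ i < n ] ∑[ k < μ (suc i) ] F (suc i , suc k)
sum-map-dgBoxes n μ F =
  trans (sum-map-concatMap F (λ i → map (i ,_) (range 1 (μ i))) (range 1 n))
  (trans (sum-map-range₁ _ n)
         (∑-cong n (λ i _ → trans (sum-map-map F (suc i ,_) (range 1 (μ (suc i))))
                                  (sum-map-range₁ (λ j → F (suc i , j)) (μ (suc i))))))

≡ᵇ-refl : ∀ x → (x ≡ᵇ x) ≡ true
≡ᵇ-refl x = dec-true (x ≟ x) refl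

<ᵇ-irrefl : ∀ x → (x <ᵇ x) ≡ false
<ᵇ-irrefl x = dec-false (x <? x) (<-irrefl refl)

≤ᵇ≡<ᵇsuc : ∀ k m → (k ≤ᵇ m) ≡ (k <ᵇ suc m)
≤ᵇ≡<ᵇsuc zero m = refl
≤ᵇ≡<ᵇsuc (suc k) m = refl

inDg'⇒inHat : ∀ n μ u → T (inDg' n μ u) → T (inHat n μ u)
inDg'⇒inHat n μ (i , j) h with 1 ≤ᵇ i | i ≤ᵇ n | 1 ≤ᵇ j | j ≤ᵇ μ i
... | true | true | true | true = tt

inHat-intro : ∀ n μ {i j} → 1 ≤ i → i ≤ n → j ≤ μ i → T (inHat n μ (i , j))
inHat-intro n μ {i} {j} 1≤i i≤n j≤μ rewrite dec-true (1 ≤? i) 1≤i | dec-true (i ≤? n) i≤n | dec-true (j ≤? μ i) j≤μ = tt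

attacks-sameRow : ∀ {i i'} j → i ≢ i' → T (attacks (i , j) (i' , j))
attacks-sameRow {i} {i'} j i≢i' rewrite dec-false (i ≟ i') i≢i' | ≡ᵇ-refl j = tt

attacks-diagonal : ∀ {i i'} j → i < i' → T (attacks (i , suc j) (i' , j))
attacks-diagonal {i} {i'} j i<i'
  rewrite dec-false (i ≟ i') (<⇒≢ i<i') | dec-false (suc j ≟ j) 1+n≢n | ≡ᵇ-refl j | dec-true (i <? i') i<i' = tt

module ArmTriples (n : ℕ) (μ : ℕ → ℕ) where

  -- (t, s, k) stands for u = (t, k+1), d(u) = (t, k) and the box w = (s, armRow t s k) of the arm of u:
  -- the first count in a(u) puts w in the row of u, the second in the row of d(u).
  leftArm rightArm : ℕ → ℕ → ℕ → Bool
  leftArm t s k = (s <ᵇ t) ∧ inDg' n μ (s , suc k) ∧ (μ s ≤ᵇ μ t)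
  rightArm t s k = (t <ᵇ s) ∧ inHat n μ (s , k) ∧ (μ s <ᵇ μ t)

  inArm : ℕ → ℕ → ℕ → ℕ
  inArm t s k = 𝟙 (leftArm t s k) + 𝟙 (rightArm t s k)

  armRow : ℕ → ℕ → ℕ → ℕ
  armRow t s k = if leftArm t s k then suc k else k

  leftArm⇒¬rightArm : ∀ t s k → leftArm t s k ≡ true → rightArm t s k ≡ false
  leftArm⇒¬rightArm t s k left with s <ᵇ t | <ᵇ-reflects-< s t
  ... | true | ofʸ s<t rewrite dec-false (t <? s) (<⇒≯ s<t) = refl

  inArm-select : ∀ t s k (h : ℕ → ℕ) → inArm t s k * h (armRow t s k) ≡ 𝟙 (leftArm t s k) * h (suc k) + 𝟙 (rightArm t s k) * h k
  inArm-select t s k h with leftArm t s k in left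
  ... | true rewrite leftArm⇒¬rightArm t s k left = sym (+-identityʳ _)
  ... | false = refl

  AttacksBothEnds : ℕ → ℕ → ℕ → Set
  AttacksBothEnds t s k =
    T (inHat n μ (s , armRow t s k)) × T (attacks (t , suc k) (s , armRow t s k)) × T (attacks (s , armRow t s k) (t , k))

  armTriple-cases : ∀ t s k → inArm t s k ≡ 0 ⊎ (inArm t s k ≡ 1 × AttacksBothEnds t s k)
  armTriple-cases t s k with leftArm t s k in left | rightArm t s k in right
  ... | true | true = contradiction (trans (sym right) (leftArm⇒¬rightArm t s k left)) λ ()
  ... | true | false = inj₂ (refl , inHat-sk , attacks-sameRow (suc k) (>⇒≢ s<t) , attacks-diagonal k s<t)
    where
    parts = Equivalence.to T-∧ (Equivalence.from T-≡ left)
    s<t = <ᵇ⇒< s t (proj₁ parts)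
    inHat-sk = inDg'⇒inHat n μ (s , suc k) (proj₁ (Equivalence.to T-∧ (proj₂ parts)))
  ... | false | true = inj₂ (refl , inHat-sk , attacks-diagonal k t<s , attacks-sameRow k (<⇒≢ t<s ∘ sym))
    where
    parts = Equivalence.to T-∧ (Equivalence.from T-≡ right)
    t<s = <ᵇ⇒< t s (proj₁ parts)
    inHat-sk = proj₁ (Equivalence.to T-∧ (proj₂ parts))
  ... | false | false = inj₁ refl

  tripleSum : (ℕ → ℕ → ℕ → ℕ) → ℕ
  tripleSum F = pairSum n (λ t s → ∑ (μ t) (F t s))

  tripleSum-cong : ∀ F G → (∀ i a k → i < n → a < n → k < μ (suc i) → F (suc i) (suc a) k ≡ G (suc i) (suc a) k) →
    tripleSum F ≡ tripleSum G
  tripleSum-cong F G eq = pairSum-cong n (λ t s → ∑ (μ t) (F t s)) (λ t s → ∑ (μ t) (G t s))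
    (λ i a i<n a<n → ∑-cong (μ (suc i)) (λ k → eq i a k i<n a<n))

  tripleSum-distrib-+ : ∀ F G → tripleSum (λ t s k → F t s k + G t s k) ≡ tripleSum F + tripleSum G
  tripleSum-distrib-+ F G =
    trans (pairSum-cong n (λ t s → ∑ (μ t) (λ k → F t s k + G t s k)) (λ t s → ∑ (μ t) (F t s) + ∑ (μ t) (G t s))
                          (λ i a _ _ → ∑-distrib-+ (μ (suc i)) (F (suc i) (suc a)) (G (suc i) (suc a))))
          (pairSum-distrib-+ n (λ t s → ∑ (μ t) (F t s)) (λ t s → ∑ (μ t) (G t s)))

  arm≡∑inArm : ∀ t k → arm n μ (t , suc k) ≡ ∑[ a < n ] inArm t (suc a) k
  arm≡∑inArm t k = trans
    (cong₂ _+_ (trans (count≡sum-𝟙 _ (range 1 n)) (sum-map-range₁ _ n))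
               (trans (count≡sum-𝟙 _ (range 1 n)) (sum-map-range₁ _ n)))
    (sym (∑-distrib-+ n _ _))

  armWeightedSum : (w : Box → ℕ) →
    sum (map (λ u → w u * arm n μ u) (dgBoxes n μ)) ≡ tripleSum (λ t s k → w (t , suc k) * inArm t s k)
  armWeightedSum w = trans (sum-map-dgBoxes n μ _) (∑-cong n (λ i _ → trans
    (∑-cong (μ (suc i)) (λ k _ → trans (cong (w (suc i , suc k) *_) (arm≡∑inArm (suc i) k))
                                       (*-distribˡ-∑ n (w (suc i , suc k)) _)))
    (∑-comm (μ (suc i)) n _)))

  totalArm≡tripleSum : totalArm n μ ≡ tripleSum inArm
  totalArm≡tripleSum = begin
    totalArm n μ                                              ≡⟨ sum-map-cong (dgBoxes n μ) (λ u → sym (*-identityˡ (arm n μ u))) ⟩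
    sum (map (λ u → 1 * arm n μ u) (dgBoxes n μ))             ≡⟨ armWeightedSum (λ _ → 1) ⟩
    tripleSum (λ t s k → 1 * inArm t s k)                     ≡⟨ tripleSum-cong (λ t s k → 1 * inArm t s k) inArm (λ i a k _ _ _ → *-identityˡ _) ⟩
    tripleSum inArm                                           ∎

  descentArmSum≡tripleSum : ∀ σ →
    descentArmSum n μ σ ≡ tripleSum (λ t s k → 𝟙 (σ t k <ᵇ σ t (suc k)) * inArm t s k)
  descentArmSum≡tripleSum σ =
    trans (sum-map-filter (isDescent σ) (arm n μ) (dgBoxes n μ)) (armWeightedSum (𝟙 ∘ isDescent σ))

  nonEqArmSum≡tripleSum : ∀ σ →
    nonEqArmSum n μ σ ≡ tripleSum (λ t s k → 𝟙 (not (σ t (suc k) ≡ᵇ σ t k)) * inArm t s k)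
  nonEqArmSum≡tripleSum σ =
    trans (sum-map-filter _ (arm n μ) (dgBoxes n μ)) (armWeightedSum (λ u → 𝟙 (not (val σ u ≡ᵇ val σ (down u)))))

module Inversions (n : ℕ) (μ : ℕ → ℕ) (σ : Filling) where

  isInversion : Box × Box → Bool
  isInversion p = attacks (proj₁ p) (proj₂ p) ∧ before (proj₁ p) (proj₂ p) ∧ (val σ (proj₂ p) <ᵇ val σ (proj₁ p))

  rowInv diagInv : ℕ → ℕ → ℕ → ℕ
  rowInv t s j = 𝟙 ((s <ᵇ t) ∧ (σ s j <ᵇ σ t j))
  diagInv t s k = 𝟙 ((t <ᵇ s) ∧ (σ s k <ᵇ σ t (suc k)))

  isInversion-sameRow : ∀ t s j → 𝟙 (isInversion ((t , j) , (s , j))) ≡ rowInv t s j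
  isInversion-sameRow t s j rewrite ≡ᵇ-refl j | <ᵇ-irrefl j with s <ᵇ t | <ᵇ-reflects-< s t
  ... | false | _ = cong 𝟙 (∧-zeroʳ _)
  ... | true | ofʸ s<t rewrite dec-false (t ≟ s) (>⇒≢ s<t) = refl

  isInversion-rowBelow : ∀ t s k → 𝟙 (isInversion ((t , suc k) , (s , k))) ≡ diagInv t s k
  isInversion-rowBelow t s k
    rewrite dec-false (suc k ≟ k) 1+n≢n | ≡ᵇ-refl k | ∧-zeroʳ (t ≡ᵇ s)
          | dec-false (k ≟ suc (suc k)) (<⇒≢ (<-trans (n<1+n k) (n<1+n (suc k))))
          | dec-true (k <? suc k) (n<1+n k) | ∨-identityʳ (t <ᵇ s) = refl

  isInversion-otherRows : ∀ t s j b → b ≢ j → suc b ≢ j → isInversion ((t , j) , (s , b)) ≡ false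
  isInversion-otherRows t s j b b≢j 1+b≢j
    rewrite dec-false (j ≟ b) (b≢j ∘ sym) | dec-false (j ≟ suc b) (1+b≢j ∘ sym) | ∧-zeroʳ (t ≡ᵇ s)
    with b <ᵇ j | <ᵇ-reflects-< b j
  ... | true | ofʸ b<j rewrite dec-false (b ≟ suc j) (<⇒≢ (<-trans b<j (n<1+n j))) = refl
  ... | false | _ = ∧-zeroʳ ((b ≡ᵇ suc j) ∧ (s <ᵇ t))

  inversion-split : ∀ t j s b →
    𝟙 (isInversion ((t , j) , (s , b))) ≡ 𝟙 (b ≡ᵇ j) * rowInv t s j + 𝟙 (suc b ≡ᵇ j) * diagInv t s b
  inversion-split t j s b with b ≟ j | suc b ≟ j
  ... | yes refl | _ = begin
    𝟙 (isInversion ((t , b) , (s , b)))                         ≡⟨ isInversion-sameRow t s b ⟩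
    rowInv t s b                                               ≡⟨ 𝟙-selectˡ (≡ᵇ-refl b) (dec-false (suc b ≟ b) 1+n≢n) ⟨
    𝟙 (b ≡ᵇ b) * rowInv t s b + 𝟙 (suc b ≡ᵇ b) * diagInv t s b ∎
  ... | no b≢j | yes refl = begin
    𝟙 (isInversion ((t , suc b) , (s , b)))                             ≡⟨ isInversion-rowBelow t s b ⟩
    diagInv t s b                                                      ≡⟨ 𝟙-selectʳ (dec-false (b ≟ suc b) b≢j) (≡ᵇ-refl b) ⟨
    𝟙 (b ≡ᵇ suc b) * rowInv t s (suc b) + 𝟙 (suc b ≡ᵇ suc b) * diagInv t s b ∎
  ... | no b≢j | no 1+b≢j rewrite dec-false (b ≟ j) b≢j | dec-false (suc b ≟ j) 1+b≢j =
    cong 𝟙 (isInversion-otherRows t s j b b≢j 1+b≢j)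

  diagInvFrom : ℕ → ℕ → ℕ → ℕ
  diagInvFrom t s zero = 0
  diagInvFrom t s (suc k) = 𝟙 (k <ᵇ suc (μ s)) * diagInv t s k

  inversionsWithColumn : ∀ t j s →
    ∑[ b < suc (μ s) ] 𝟙 (isInversion ((t , j) , (s , b))) ≡ 𝟙 (j <ᵇ suc (μ s)) * rowInv t s j + diagInvFrom t s j
  inversionsWithColumn t j s = begin
    ∑[ b < suc (μ s) ] 𝟙 (isInversion ((t , j) , (s , b)))
      ≡⟨ ∑-cong (suc (μ s)) (λ b _ → inversion-split t j s b) ⟩
    ∑[ b < suc (μ s) ] (𝟙 (b ≡ᵇ j) * rowInv t s j + 𝟙 (suc b ≡ᵇ j) * diagInv t s b)
      ≡⟨ ∑-distrib-+ (suc (μ s)) (λ b → 𝟙 (b ≡ᵇ j) * rowInv t s j) (λ b → 𝟙 (suc b ≡ᵇ j) * diagInv t s b) ⟩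
    ∑[ b < suc (μ s) ] (𝟙 (b ≡ᵇ j) * rowInv t s j) + ∑[ b < suc (μ s) ] (𝟙 (suc b ≡ᵇ j) * diagInv t s b)
      ≡⟨ cong₂ _+_ (∑-δ (suc (μ s)) j (λ _ → rowInv t s j)) (diagonal j) ⟩
    𝟙 (j <ᵇ suc (μ s)) * rowInv t s j + diagInvFrom t s j
      ∎
    where
    diagonal : ∀ j → ∑[ b < suc (μ s) ] (𝟙 (suc b ≡ᵇ j) * diagInv t s b) ≡ diagInvFrom t s j
    diagonal zero = ∑-zero (suc (μ s)) (λ _ _ → refl)
    diagonal (suc k) = ∑-δ (suc (μ s)) k (diagInv t s)

  rowPairs diagPairs : ℕ → ℕ → ℕ
  rowPairs t s = ∑[ j < suc (μ t) ] (𝟙 (j <ᵇ suc (μ s)) * rowInv t s j)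
  diagPairs t s = ∑[ k < μ t ] (𝟙 (k <ᵇ suc (μ s)) * diagInv t s k)

  invCount≡columnPairs : invCount n μ σ ≡ pairSum n (λ t s → rowPairs t s + diagPairs t s)
  invCount≡columnPairs = begin
    invCount n μ σ
      ≡⟨ count≡sum-𝟙 isInversion (cartesianProduct (hatBoxes n μ) (hatBoxes n μ)) ⟩
    sum (map (𝟙 ∘ isInversion) (cartesianProduct (hatBoxes n μ) (hatBoxes n μ)))
      ≡⟨ sum-map-cartesianProduct (𝟙 ∘ isInversion) (hatBoxes n μ) (hatBoxes n μ) ⟩
    sum (map (λ u → sum (map (λ v → 𝟙 (isInversion (u , v))) (hatBoxes n μ))) (hatBoxes n μ))
      ≡⟨ sum-map-hatBoxes n μ _ ⟩
    ∑[ i < n ] ∑[ j < suc (μ (suc i)) ] sum (map (λ v → 𝟙 (isInversion ((suc i , j) , v))) (hatBoxes n μ))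
      ≡⟨ ∑-cong n (λ i _ → ∑-cong (suc (μ (suc i))) (λ j _ → trans (sum-map-hatBoxes n μ (λ v → 𝟙 (isInversion ((suc i , j) , v))))
                               (∑-cong n (λ a _ → inversionsWithColumn (suc i) j (suc a))))) ⟩
    ∑[ i < n ] ∑[ j < suc (μ (suc i)) ] ∑[ a < n ] (𝟙 (j <ᵇ suc (μ (suc a))) * rowInv (suc i) (suc a) j + diagInvFrom (suc i) (suc a) j)
      ≡⟨ ∑-cong n (λ i _ → trans (∑-comm (suc (μ (suc i))) n (λ j a → row (suc i) (suc a) j + diagInvFrom (suc i) (suc a) j))
                                 (∑-cong n (λ a _ → ∑-distrib-+ (suc (μ (suc i))) (row (suc i) (suc a)) (diagInvFrom (suc i) (suc a))))) ⟩
    ∑[ i < n ] ∑[ a < n ] (rowPairs (suc i) (suc a) + diagPairs (suc i) (suc a))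
      ∎
    where
    row : ℕ → ℕ → ℕ → ℕ
    row t s j = 𝟙 (j <ᵇ suc (μ s)) * rowInv t s j

module InversionTriples (n : ℕ) (μ : ℕ → ℕ) (σ : Filling) where
  open ArmTriples n μ
  open Inversions n μ σ

  -- upper: the pair {u, w}; lower: the pair {w, d(u)}.
  upperLeft lowerLeft upperRight lowerRight : ℕ → ℕ → ℕ → ℕ
  upperLeft t s k = 𝟙 (leftArm t s k) * 𝟙 (σ s (suc k) <ᵇ σ t (suc k))
  lowerLeft t s k = 𝟙 (leftArm t s k) * 𝟙 (σ t k <ᵇ σ s (suc k))
  upperRight t s k = 𝟙 (rightArm t s k) * 𝟙 (σ s k <ᵇ σ t (suc k))
  lowerRight t s k = 𝟙 (rightArm t s k) * 𝟙 (σ t k <ᵇ σ s k)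

  basementPair : (ℕ → ℕ) → ℕ → ℕ → ℕ
  basementPair π t s = 𝟙 ((s <ᵇ t) ∧ (μ s ≤ᵇ μ t) ∧ (π s <ᵇ π t))

  module _ (π : ℕ → ℕ) (basement : ∀ i → 1 ≤ i → i ≤ n → σ i 0 ≡ π i)
           (i a : ℕ) (i<n : i < n) (a<n : a < n) where

    private
      t s : ℕ
      t = suc i
      s = suc a

    -- For s < t and μ s ≤ μ t, the pair in row 0 is a basement pair and the pair in row j > 0 is {u, w}
    -- with u = (t, j); for μ t < μ s, the pair in row j is {w, d(u)} with u = (s, j+1).
    rowPairs-split : rowPairs t s ≡ basementPair π t s + ∑ (μ t) (upperLeft t s) + ∑ (μ s) (lowerRight s t)
    rowPairs-split with a <? i | μ s ≤? μ t
    ... | no a≮i | _ = trans (∑-zero (suc (μ t)) (λ j _ → lhs j))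
                             (sym (cong₂ _+_ (cong₂ _+_ bp (∑-zero (μ t) (λ k _ → ul k))) (∑-zero (μ s) (λ k _ → lr k))))
      where
      a<ᵇi = dec-false (a <? i) a≮i
      bp : basementPair π t s ≡ 0
      bp rewrite a<ᵇi = refl
      lhs : ∀ j → 𝟙 (j <ᵇ suc (μ s)) * rowInv t s j ≡ 0
      lhs j rewrite a<ᵇi = *-zeroʳ (𝟙 (j <ᵇ suc (μ s)))
      ul : ∀ k → upperLeft t s k ≡ 0
      ul k rewrite a<ᵇi = refl
      lr : ∀ k → lowerRight s t k ≡ 0
      lr k rewrite a<ᵇi = refl
    ... | yes a<i | yes μs≤μt =
      trans (cong₂ _+_ row₀ (∑-cong (μ t) (λ k _ → ul k)))
            (sym (trans (cong (basementPair π t s + ∑ (μ t) (upperLeft t s) +_) (∑-zero (μ s) (λ k _ → lr k))) (+-identityʳ _)))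
      where
      a<ᵇi = dec-true (a <? i) a<i
      μs≤ᵇμt = dec-true (μ s ≤? μ t) μs≤μt
      row₀ : 𝟙 (0 <ᵇ suc (μ s)) * rowInv t s 0 ≡ basementPair π t s
      row₀ rewrite a<ᵇi | μs≤ᵇμt | basement s (s≤s z≤n) a<n | basement t (s≤s z≤n) i<n = +-identityʳ _
      ul : ∀ k → 𝟙 (suc k <ᵇ suc (μ s)) * rowInv t s (suc k) ≡ upperLeft t s k
      ul k rewrite a<ᵇi | μs≤ᵇμt | dec-true (a <? n) a<n | ∧-identityʳ (k <ᵇ μ s) = refl
      lr : ∀ k → lowerRight s t k ≡ 0
      lr k rewrite a<ᵇi | dec-false (μ t <? μ s) (≤⇒≯ μs≤μt) | ∧-zeroʳ ((i <ᵇ n) ∧ (k ≤ᵇ μ t)) = refl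
    ... | yes a<i | no μs≰μt =
      trans (∑-pad (λ j → 𝟙 (j <ᵇ suc (μ s)) * rowInv t s j) μt<μs)
            (trans (∑-cong (μ s) lr)
                   (sym (cong (_+ ∑ (μ s) (lowerRight s t)) (cong₂ _+_ bp (∑-zero (μ t) (λ k _ → ul k))))))
      where
      μt<μs = ≰⇒> μs≰μt
      a<ᵇi = dec-true (a <? i) a<i
      μs≤ᵇμt = dec-false (μ s ≤? μ t) μs≰μt
      bp : basementPair π t s ≡ 0
      bp rewrite a<ᵇi | μs≤ᵇμt = refl
      ul : ∀ k → upperLeft t s k ≡ 0
      ul k rewrite a<ᵇi | μs≤ᵇμt | ∧-zeroʳ ((a <ᵇ n) ∧ (k <ᵇ μ s)) = refl
      lr : ∀ k → k < μ s → 𝟙 (k <ᵇ suc (μ t)) * (𝟙 (k <ᵇ suc (μ s)) * rowInv t s k) ≡ lowerRight s t k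
      lr k k<μs rewrite a<ᵇi | dec-true (i <? n) i<n | dec-true (μ t <? μ s) μt<μs
                      | dec-true (k <? suc (μ s)) (m<n⇒m<1+n k<μs) | ≤ᵇ≡<ᵇsuc k (μ t) | ∧-identityʳ (k <ᵇ suc (μ t)) =
        cong (𝟙 (k <ᵇ suc (μ t)) *_) (+-identityʳ _)

    -- For t < s, the pair (t, k+1), (s, k) is {u, w} with u = (t, k+1) if μ s < μ t,
    -- and {w, d(u)} with u = (s, k+1) otherwise.
    diagPairs-split : diagPairs t s ≡ ∑ (μ t) (upperRight t s) + ∑ (μ s) (lowerLeft s t)
    diagPairs-split with i <? a | μ s <? μ t
    ... | no i≮a | _ = trans (∑-zero (μ t) (λ k _ → lhs k))
                             (sym (cong₂ _+_ (∑-zero (μ t) (λ k _ → ur k)) (∑-zero (μ s) (λ k _ → ll k))))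
      where
      i<ᵇa = dec-false (i <? a) i≮a
      lhs : ∀ k → 𝟙 (k <ᵇ suc (μ s)) * diagInv t s k ≡ 0
      lhs k rewrite i<ᵇa = *-zeroʳ (𝟙 (k <ᵇ suc (μ s)))
      ur : ∀ k → upperRight t s k ≡ 0
      ur k rewrite i<ᵇa = refl
      ll : ∀ k → lowerLeft s t k ≡ 0
      ll k rewrite i<ᵇa = refl
    ... | yes i<a | yes μs<μt =
      trans (∑-cong (μ t) (λ k _ → ur k))
            (sym (trans (cong (∑ (μ t) (upperRight t s) +_) (∑-zero (μ s) (λ k _ → ll k))) (+-identityʳ _)))
      where
      i<ᵇa = dec-true (i <? a) i<a
      μs<ᵇμt = dec-true (μ s <? μ t) μs<μt
      ur : ∀ k → 𝟙 (k <ᵇ suc (μ s)) * diagInv t s k ≡ upperRight t s k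
      ur k rewrite i<ᵇa | μs<ᵇμt | dec-true (a <? n) a<n | ≤ᵇ≡<ᵇsuc k (μ s) | ∧-identityʳ (k <ᵇ suc (μ s)) = refl
      ll : ∀ k → lowerLeft s t k ≡ 0
      ll k rewrite i<ᵇa | dec-false (μ t ≤? μ s) (<⇒≱ μs<μt) | ∧-zeroʳ ((i <ᵇ n) ∧ (k <ᵇ μ t)) = refl
    ... | yes i<a | no μs≮μt =
      trans (∑-pad (λ k → 𝟙 (k <ᵇ suc (μ s)) * diagInv t s k) μt≤μs)
            (trans (∑-cong (μ s) ll) (sym (cong (_+ ∑ (μ s) (lowerLeft s t)) (∑-zero (μ t) (λ k _ → ur k)))))
      where
      μt≤μs = ≮⇒≥ μs≮μt
      i<ᵇa = dec-true (i <? a) i<a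
      ur : ∀ k → upperRight t s k ≡ 0
      ur k rewrite i<ᵇa | dec-false (μ s <? μ t) μs≮μt | ∧-zeroʳ ((a <ᵇ n) ∧ (k ≤ᵇ μ s)) = refl
      ll : ∀ k → k < μ s → 𝟙 (k <ᵇ μ t) * (𝟙 (k <ᵇ suc (μ s)) * diagInv t s k) ≡ lowerLeft s t k
      ll k k<μs rewrite i<ᵇa | dec-true (i <? n) i<n | dec-true (μ t ≤? μ s) μt≤μs
                      | dec-true (k <? suc (μ s)) (m<n⇒m<1+n k<μs) | ∧-identityʳ (k <ᵇ μ t) =
        cong (𝟙 (k <ᵇ μ t) *_) (+-identityʳ _)

  pairInversions : ℕ → ℕ → ℕ → ℕ
  pairInversions t k y = 𝟙 (y <ᵇ σ t (suc k)) + 𝟙 (σ t k <ᵇ y)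

  tripleInversions : ℕ → ℕ → ℕ → ℕ
  tripleInversions t s k = pairInversions t k (σ s (armRow t s k))

  tripleInversions-split : ∀ t s k → inArm t s k * tripleInversions t s k ≡
    (upperLeft t s k + lowerLeft t s k) + (upperRight t s k + lowerRight t s k)
  tripleInversions-split t s k = trans (inArm-select t s k (λ r → pairInversions t k (σ s r)))
    (cong₂ _+_ (*-distribˡ-+ (𝟙 (leftArm t s k)) _ _) (*-distribˡ-+ (𝟙 (rightArm t s k)) _ _))

  basementCount≡pairSum : ∀ π → basementCount n μ π ≡ pairSum n (basementPair π)
  basementCount≡pairSum π = begin
    basementCount n μ π
      ≡⟨ count≡sum-𝟙 _ (cartesianProduct (range 1 n) (range 1 n)) ⟩
    sum (map (λ p → basement p) (cartesianProduct (range 1 n) (range 1 n)))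
      ≡⟨ sum-map-cartesianProduct basement (range 1 n) (range 1 n) ⟩
    sum (map (λ s → sum (map (λ t → basement (s , t)) (range 1 n))) (range 1 n))
      ≡⟨ trans (sum-map-range₁ _ n) (∑-cong n (λ a _ → sum-map-range₁ (λ t → basement (suc a , t)) n)) ⟩
    pairSum n (λ s t → basementPair π t s)
      ≡⟨ pairSum-transpose n (basementPair π) ⟩
    pairSum n (basementPair π)
      ∎
    where
    basement : ℕ × ℕ → ℕ
    basement p = 𝟙 ((proj₁ p <ᵇ proj₂ p) ∧ (μ (proj₁ p) ≤ᵇ μ (proj₂ p)) ∧ (π (proj₁ p) <ᵇ π (proj₂ p)))

  invCount≡basement+triples : ∀ π → (∀ i → 1 ≤ i → i ≤ n → σ i 0 ≡ π i) →
    invCount n μ σ ≡ basementCount n μ π + tripleSum (λ t s k → inArm t s k * tripleInversions t s k)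
  invCount≡basement+triples π basement = begin
    invCount n μ σ
      ≡⟨ invCount≡columnPairs ⟩
    pairSum n (λ t s → rowPairs t s + diagPairs t s)
      ≡⟨ pairSum-cong n (λ t s → rowPairs t s + diagPairs t s) (λ t s → basementPair π t s + (upper t s + lower s t)) regroup ⟩
    pairSum n (λ t s → basementPair π t s + (upper t s + lower s t))
      ≡⟨ trans (pairSum-distrib-+ n (basementPair π) (λ t s → upper t s + lower s t))
               (cong (pairSum n (basementPair π) +_) (pairSum-distrib-+ n upper (λ t s → lower s t))) ⟩
    pairSum n (basementPair π) + (pairSum n upper + pairSum n (λ t s → lower s t))
      ≡⟨ cong₂ (λ b l → b + (pairSum n upper + l)) (sym (basementCount≡pairSum π)) (pairSum-transpose n lower) ⟩
    basementCount n μ π + (pairSum n upper + pairSum n lower)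
      ≡⟨ cong (basementCount n μ π +_) (sym (pairSum-distrib-+ n upper lower)) ⟩
    basementCount n μ π + pairSum n (λ t s → upper t s + lower t s)
      ≡⟨ cong (basementCount n μ π +_) (sym (pairSum-cong n (λ t s → ∑ (μ t) (λ k → inArm t s k * tripleInversions t s k))
                                                          (λ t s → upper t s + lower t s) (λ i a _ _ → triples (suc i) (suc a)))) ⟩
    basementCount n μ π + tripleSum (λ t s k → inArm t s k * tripleInversions t s k)
      ∎
    where
    upper lower : ℕ → ℕ → ℕ
    upper t s = ∑ (μ t) (upperLeft t s) + ∑ (μ t) (upperRight t s)
    lower t s = ∑ (μ t) (lowerRight t s) + ∑ (μ t) (lowerLeft t s)

    regroup : ∀ i a → i < n → a < n → rowPairs (suc i) (suc a) + diagPairs (suc i) (suc a) ≡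
      basementPair π (suc i) (suc a) + (upper (suc i) (suc a) + lower (suc a) (suc i))
    regroup i a i<n a<n = trans (cong₂ _+_ (rowPairs-split π basement i a i<n a<n) (diagPairs-split π basement i a i<n a<n))
                                (shuffle (basementPair π t s) (∑ (μ t) (upperLeft t s)) (∑ (μ s) (lowerRight s t))
                                         (∑ (μ t) (upperRight t s)) (∑ (μ s) (lowerLeft s t)))
      where
      t s : ℕ
      t = suc i
      s = suc a
      shuffle : ∀ b ul lr ur ll → (b + ul + lr) + (ur + ll) ≡ b + ((ul + ur) + (lr + ll))
      shuffle = solve-∀

    triples : ∀ t s → ∑ (μ t) (λ k → inArm t s k * tripleInversions t s k) ≡ upper t s + lower t s
    triples t s = begin
      ∑ (μ t) (λ k → inArm t s k * tripleInversions t s k)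
        ≡⟨ ∑-cong (μ t) (λ k _ → tripleInversions-split t s k) ⟩
      ∑[ k < μ t ] ((upperLeft t s k + lowerLeft t s k) + (upperRight t s k + lowerRight t s k))
        ≡⟨ ∑-distrib-+ (μ t) _ _ ⟩
      ∑[ k < μ t ] (upperLeft t s k + lowerLeft t s k) + ∑[ k < μ t ] (upperRight t s k + lowerRight t s k)
        ≡⟨ cong₂ _+_ (∑-distrib-+ (μ t) _ _) (∑-distrib-+ (μ t) _ _) ⟩
      (∑ (μ t) (upperLeft t s) + ∑ (μ t) (lowerLeft t s)) + (∑ (μ t) (upperRight t s) + ∑ (μ t) (lowerRight t s))
        ≡⟨ shuffle (∑ (μ t) (upperLeft t s)) (∑ (μ t) (lowerLeft t s)) (∑ (μ t) (upperRight t s)) (∑ (μ t) (lowerRight t s)) ⟩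
      upper t s + lower t s
        ∎
      where
      shuffle : ∀ ul ll ur lr → (ul + ll) + (ur + lr) ≡ (ul + ur) + (lr + ll)
      shuffle = solve-∀

descents ascents : ℕ → ℕ → ℕ → ℕ
descents x y z = 𝟙 (y <ᵇ x) + 𝟙 (z <ᵇ y) + 𝟙 (x <ᵇ z)
ascents x y z = 𝟙 (x <ᵇ y) + 𝟙 (y <ᵇ z) + 𝟙 (z <ᵇ x)

descents-rotate : ∀ x y z → descents x y z ≡ descents y z x
descents-rotate x y z = rotate (𝟙 (y <ᵇ x)) (𝟙 (z <ᵇ y)) (𝟙 (x <ᵇ z))
  where
  rotate : ∀ a b c → a + b + c ≡ b + c + a
  rotate = solve-∀

ascents+descents : ∀ {x y z} → x ≢ y → y ≢ z → z ≢ x → ascents x y z + descents x y z ≡ 3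
ascents+descents {x} {y} {z} x≢y y≢z z≢x = begin
  ascents x y z + descents x y z
    ≡⟨ pair-up (𝟙 (x <ᵇ y)) (𝟙 (y <ᵇ z)) (𝟙 (z <ᵇ x)) (𝟙 (y <ᵇ x)) (𝟙 (z <ᵇ y)) (𝟙 (x <ᵇ z)) ⟩
  (𝟙 (x <ᵇ y) + 𝟙 (y <ᵇ x)) + (𝟙 (y <ᵇ z) + 𝟙 (z <ᵇ y)) + (𝟙 (z <ᵇ x) + 𝟙 (x <ᵇ z))
    ≡⟨ cong₂ _+_ (cong₂ _+_ (𝟙-<ᵇ-swap x≢y) (𝟙-<ᵇ-swap y≢z)) (𝟙-<ᵇ-swap z≢x) ⟩
  3 ∎
  where
  pair-up : ∀ a b c a' b' c' → (a + b + c) + (a' + b' + c') ≡ (a + a') + (b + b') + (c + c')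
  pair-up = solve-∀

∸-<ᵇ-reverse : ∀ {a b c} → a ≤ c → b ≤ c → (c ∸ a <ᵇ c ∸ b) ≡ (b <ᵇ a)
∸-<ᵇ-reverse {a} {b} {c} a≤c b≤c with b <? a
... | yes b<a = trans (dec-true (c ∸ a <? c ∸ b) (∸-monoʳ-< b<a a≤c)) (sym (dec-true (b <? a) b<a))
... | no b≮a = trans (dec-false (c ∸ a <? c ∸ b) (≤⇒≯ (∸-monoʳ-≤ c (≮⇒≥ b≮a)))) (sym (dec-false (b <? a) b≮a))

module Complement (n m : ℕ) where

  complement : ℕ → ℕ
  complement v = if v ≤ᵇ m then suc m ∸ v else n + m + 1 ∸ v

  InRange : ℕ → Set
  InRange v = 1 ≤ v × v ≤ n

  complement-inside : ∀ {u v} → InRange u → InRange v → (u ≤ᵇ m) ≡ (v ≤ᵇ m) →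
    (complement u <ᵇ complement v) ≡ (v <ᵇ u)
  complement-inside {u} {v} (_ , u≤n) (_ , v≤n) same with u ≤ᵇ m | ≤ᵇ-reflects-≤ u m | v ≤ᵇ m | ≤ᵇ-reflects-≤ v m
  ... | true | ofʸ u≤m | true | ofʸ v≤m = ∸-<ᵇ-reverse (m≤n⇒m≤1+n u≤m) (m≤n⇒m≤1+n v≤m)
  ... | false | _ | false | _ = ∸-<ᵇ-reverse (≤-trans u≤n n≤n+m+1) (≤-trans v≤n n≤n+m+1)
    where
    n≤n+m+1 : n ≤ n + m + 1
    n≤n+m+1 = ≤-trans (m≤m+n n m) (m≤m+n (n + m) 1)

  low-image<high-image : ∀ {u v} → 1 ≤ u → v ≤ n → suc m ∸ u < n + m + 1 ∸ v
  low-image<high-image {u} {v} 1≤u v≤n =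
    ≤-trans (s≤s (∸-monoʳ-≤ (suc m) 1≤u)) (≤-trans (≤-reflexive m+1≡n+m+1∸n) (∸-monoʳ-≤ (n + m + 1) v≤n))
    where
    m+1≡n+m+1∸n : suc m ≡ n + m + 1 ∸ n
    m+1≡n+m+1∸n = sym (trans (cong (_∸ n) (+-assoc n m 1)) (trans (m+n∸m≡n n (m + 1)) (+-comm m 1)))

  complement-across : ∀ {u v} → InRange u → InRange v → (u ≤ᵇ m) ≢ (v ≤ᵇ m) →
    (complement u <ᵇ complement v) ≡ (u <ᵇ v)
  complement-across {u} {v} u∈ v∈ differ with u ≤ᵇ m | ≤ᵇ-reflects-≤ u m | v ≤ᵇ m | ≤ᵇ-reflects-≤ v m
  ... | true | ofʸ u≤m | false | ofⁿ v≰m =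
    trans (dec-true (suc m ∸ u <? n + m + 1 ∸ v) (low-image<high-image (proj₁ u∈) (proj₂ v∈)))
          (sym (dec-true (u <? v) (≤-<-trans u≤m (≰⇒> v≰m))))
  ... | false | ofⁿ u≰m | true | ofʸ v≤m =
    trans (dec-false (n + m + 1 ∸ u <? suc m ∸ v) (<⇒≯ (low-image<high-image (proj₁ v∈) (proj₂ u∈))))
          (sym (dec-false (u <? v) (<⇒≯ (≤-<-trans v≤m (≰⇒> u≰m)))))
  ... | true | _ | true | _ = contradiction refl differ
  ... | false | _ | false | _ = contradiction refl differ

  block-extreme : ∀ x y z → (x ≤ᵇ m) ≢ (y ≤ᵇ m) → (y ≤ᵇ m) ≡ (z ≤ᵇ m) → 𝟙 (y <ᵇ x) + 𝟙 (x <ᵇ z) ≡ 1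
  block-extreme x y z differ same
    with x ≤ᵇ m | ≤ᵇ-reflects-≤ x m | y ≤ᵇ m | ≤ᵇ-reflects-≤ y m | z ≤ᵇ m | ≤ᵇ-reflects-≤ z m
  ... | true | ofʸ x≤m | false | ofⁿ y≰m | false | ofⁿ z≰m
    rewrite dec-false (y <? x) (<⇒≯ (≤-<-trans x≤m (≰⇒> y≰m))) | dec-true (x <? z) (≤-<-trans x≤m (≰⇒> z≰m)) = refl
  ... | false | ofⁿ x≰m | true | ofʸ y≤m | true | ofʸ z≤m
    rewrite dec-true (y <? x) (≤-<-trans y≤m (≰⇒> x≰m)) | dec-false (x <? z) (<⇒≯ (≤-<-trans z≤m (≰⇒> x≰m))) = refl
  ... | true | _ | true | _ | _ | _ = contradiction refl differ
  ... | false | _ | false | _ | _ | _ = contradiction refl differ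

  module _ {x y z : ℕ} (x∈ : InRange x) (y∈ : InRange y) (z∈ : InRange z) where

    descents-complement-uniform : (x ≤ᵇ m) ≡ (y ≤ᵇ m) → (y ≤ᵇ m) ≡ (z ≤ᵇ m) → x ≢ y → y ≢ z → z ≢ x →
      descents (complement x) (complement y) (complement z) + descents x y z ≡ 3
    descents-complement-uniform xy yz x≢y y≢z z≢x
      rewrite complement-inside y∈ x∈ (sym xy) | complement-inside z∈ y∈ (sym yz) | complement-inside x∈ z∈ (trans xy yz) =
      ascents+descents x≢y y≢z z≢x

    descents-complement-odd : (x ≤ᵇ m) ≢ (y ≤ᵇ m) → (y ≤ᵇ m) ≡ (z ≤ᵇ m) → y ≢ z →
      descents (complement x) (complement y) (complement z) + descents x y z ≡ 3
    descents-complement-odd differ same y≢z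
      rewrite complement-across y∈ x∈ (differ ∘ sym) | complement-inside z∈ y∈ (sym same)
            | complement-across x∈ z∈ (λ xz → differ (trans xz (sym same))) =
      trans (regroup (𝟙 (y <ᵇ x)) (𝟙 (y <ᵇ z)) (𝟙 (x <ᵇ z)) (𝟙 (z <ᵇ y)))
            (cong₂ _+_ (cong₂ _+_ (block-extreme x y z differ same) (block-extreme x y z differ same)) (𝟙-<ᵇ-swap y≢z))
      where
      regroup : ∀ a b c b' → a + b + c + (a + b' + c) ≡ (a + c) + (a + c) + (b + b')
      regroup = solve-∀

  descents-complement-rotate : ∀ x y z →
    descents (complement y) (complement z) (complement x) + descents y z x ≡ 3 →
    descents (complement x) (complement y) (complement z) + descents x y z ≡ 3
  descents-complement-rotate x y z =
    trans (cong₂ _+_ (descents-rotate (complement x) (complement y) (complement z)) (descents-rotate x y z))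

  -- Modulo n, complement v ≡ m + 1 - v, a reflection of the cyclic order of [1, n].
  descents-complement : ∀ {x y z} → InRange x → InRange y → InRange z → x ≢ y → y ≢ z → z ≢ x →
    descents (complement x) (complement y) (complement z) + descents x y z ≡ 3
  descents-complement {x} {y} {z} x∈ y∈ z∈ x≢y y≢z z≢x with (x ≤ᵇ m) Bool.≟ (y ≤ᵇ m) | (y ≤ᵇ m) Bool.≟ (z ≤ᵇ m)
  ... | yes xy | yes yz = descents-complement-uniform x∈ y∈ z∈ xy yz x≢y y≢z z≢x
  ... | no xy | yes yz = descents-complement-odd x∈ y∈ z∈ xy yz y≢z
  ... | yes xy | no yz = descents-complement-rotate x y z (descents-complement-rotate y z x
                           (descents-complement-odd z∈ x∈ y∈ (λ zx → yz (sym (trans zx xy))) xy x≢y))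
  ... | no xy | no yz = descents-complement-rotate x y z
                           (descents-complement-odd y∈ z∈ x∈ yz (sym (two-≢⇒≡ xy yz)) z≢x)
    where
    two-≢⇒≡ : ∀ {a b c : Bool} → a ≢ b → b ≢ c → a ≡ c
    two-≢⇒≡ {false} {false} a≢b _ = contradiction refl a≢b
    two-≢⇒≡ {true} {true} a≢b _ = contradiction refl a≢b
    two-≢⇒≡ {false} {true} {false} _ _ = refl
    two-≢⇒≡ {false} {true} {true} _ b≢c = contradiction refl b≢c
    two-≢⇒≡ {true} {false} {false} _ b≢c = contradiction refl b≢c
    two-≢⇒≡ {true} {false} {true} _ _ = refl

  complement-𝟙-<ᵇ-swap : ∀ {u v} → InRange u → InRange v → u ≢ v →
    𝟙 (complement u <ᵇ complement v) + 𝟙 (complement v <ᵇ complement u) ≡ 1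
  complement-𝟙-<ᵇ-swap {u} {v} u∈ v∈ u≢v with (u ≤ᵇ m) Bool.≟ (v ≤ᵇ m)
  ... | yes same rewrite complement-inside u∈ v∈ same | complement-inside v∈ u∈ (sym same) =
    trans (+-comm (𝟙 (v <ᵇ u)) _) (𝟙-<ᵇ-swap u≢v)
  ... | no differ rewrite complement-across u∈ v∈ differ | complement-across v∈ u∈ (differ ∘ sym) = 𝟙-<ᵇ-swap u≢v

  -- For x ≢ z, adding [x < z] and its image to both sides turns them into cyclic descent counts.
  complement-triple : ∀ {x y z} → InRange x → InRange y → InRange z → x ≢ y → y ≢ z →
    2 + 𝟙 (z <ᵇ x) + 𝟙 (complement z <ᵇ complement x) ≡
    𝟙 (not (x ≡ᵇ z)) + (𝟙 (y <ᵇ x) + 𝟙 (z <ᵇ y)) + (𝟙 (complement y <ᵇ complement x) + 𝟙 (complement z <ᵇ complement y))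
  complement-triple {x} {y} {z} x∈ y∈ z∈ x≢y y≢z with x ≟ z
  ... | yes refl rewrite <ᵇ-irrefl x | <ᵇ-irrefl (complement x) | ≡ᵇ-refl x =
    sym (cong₂ _+_ (𝟙-<ᵇ-swap y≢z) (complement-𝟙-<ᵇ-swap y∈ x∈ y≢z))
  ... | no x≢z rewrite dec-false (x ≟ z) x≢z = +-cancelˡ-≡ (b + b′) _ _ (begin
    b + b′ + (2 + a + a′)                ≡⟨ regroupˡ b b′ a a′ ⟩
    2 + (a + b) + (a′ + b′)              ≡⟨ cong₂ (λ p q → 2 + p + q) (𝟙-<ᵇ-swap (x≢z ∘ sym)) (complement-𝟙-<ᵇ-swap z∈ x∈ (x≢z ∘ sym)) ⟩
    4                                    ≡⟨ cong suc (descents-complement x∈ y∈ z∈ x≢y y≢z (x≢z ∘ sym)) ⟨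
    1 + (descents cx cy cz + descents x y z) ≡⟨ regroupʳ b b′ (𝟙 (y <ᵇ x)) (𝟙 (z <ᵇ y)) (𝟙 (cy <ᵇ cx)) (𝟙 (cz <ᵇ cy)) ⟩
    b + b′ + (1 + (𝟙 (y <ᵇ x) + 𝟙 (z <ᵇ y)) + (𝟙 (cy <ᵇ cx) + 𝟙 (cz <ᵇ cy))) ∎)
    where
    cx = complement x
    cy = complement y
    cz = complement z
    a = 𝟙 (z <ᵇ x)
    a′ = 𝟙 (cz <ᵇ cx)
    b = 𝟙 (x <ᵇ z)
    b′ = 𝟙 (cx <ᵇ cz)
    regroupˡ : ∀ b b′ a a′ → b + b′ + (2 + a + a′) ≡ 2 + (a + b) + (a′ + b′)
    regroupˡ = solve-∀
    regroupʳ : ∀ b b′ p q p′ q′ → 1 + ((p′ + q′ + b′) + (p + q + b)) ≡ b + b′ + (1 + (p + q) + (p′ + q′))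
    regroupʳ = solve-∀

  complement-basement : ∀ {π₁ π₂} → IsPermOn 1 m π₁ → IsPermOn (m + 1) n π₂ → ∀ {t} → 1 ≤ t → t ≤ n →
    concatPerm m (compl 1 m π₁) (compl (m + 1) n π₂) t ≡ complement (concatPerm m π₁ π₂ t)
  complement-basement {π₁} {π₂} P₁ P₂ {t} 1≤t t≤n with t ≤? m
  ... | yes t≤m rewrite dec-true (t ≤? m) t≤m | dec-true (π₁ t ≤? m) (proj₂ (proj₁ P₁ t 1≤t t≤m)) = refl
  ... | no t≰m rewrite dec-false (t ≤? m) t≰m
                     | dec-false (π₂ t ≤? m)
                         (<⇒≱ (subst (_≤ π₂ t) (+-comm m 1) (proj₁ (proj₁ P₂ t (subst (_≤ t) (+-comm 1 m) (≰⇒> t≰m)) t≤n)))) =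
    cong (_∸ π₂ t) (m+1+n≡n+m+1 m n)
    where
    m+1+n≡n+m+1 : ∀ m n → m + 1 + n ≡ n + m + 1
    m+1+n≡n+m+1 = solve-∀

weighted-by-indicator : ∀ w a b c p q → w ≡ 0 ⊎ (w ≡ 1 × 2 + a + b ≡ c + p + q) →
  w + w + a * w + b * w ≡ c * w + w * p + w * q
weighted-by-indicator _ a b c p q (inj₁ refl) rewrite *-zeroʳ a | *-zeroʳ b | *-zeroʳ c = refl
weighted-by-indicator _ a b c p q (inj₂ (refl , eq)) = trans (unit-weightˡ a b) (trans eq (unit-weightʳ c p q))
  where
  unit-weightˡ : ∀ a b → 1 + 1 + a * 1 + b * 1 ≡ 2 + a + b
  unit-weightˡ = solve-∀
  unit-weightʳ : ∀ c p q → c + p + q ≡ c * 1 + 1 * p + 1 * q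
  unit-weightʳ = solve-∀

module _ where
  open import Data.Integer using (ℤ; +_; _-_)

  coinv≡coinv'-byTriples : ∀ n μ π π′ σ σ′ {a b} →
    invCount n μ σ ≡ basementCount n μ π + a →
    invCount n μ σ′ ≡ basementCount n μ π′ + b →
    totalArm n μ + totalArm n μ + descentArmSum n μ σ + descentArmSum n μ σ′ ≡ nonEqArmSum n μ σ + a + b →
    coinv n μ π′ σ′ ≡ coinv' n μ π σ
  coinv≡coinv'-byTriples n μ π π′ σ σ′ {a} {b} inv≡ inv′≡ arms
    rewrite inv≡ | inv′≡ | ℤ.pos-+ (basementCount n μ π) a | ℤ.pos-+ (basementCount n μ π′) b =
    cancel (+ totalArm n μ) (+ descentArmSum n μ σ) (+ descentArmSum n μ σ′) (+ nonEqArmSum n μ σ)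
           (+ basementCount n μ π) (+ basementCount n μ π′) (+ a) (+ b)
           (trans (sym (cast₄ (totalArm n μ) (totalArm n μ) (descentArmSum n μ σ) (descentArmSum n μ σ′)))
                  (trans (cong +_ arms) (cast₃ (nonEqArmSum n μ σ) a b)))
    where
    cast₃ : ∀ p q r → + (p + q + r) ≡ + p ℤ.+ + q ℤ.+ + r
    cast₃ p q r = trans (ℤ.pos-+ (p + q) r) (cong (ℤ._+ + r) (ℤ.pos-+ p q))
    cast₄ : ∀ p q r s → + (p + q + r + s) ≡ + p ℤ.+ + q ℤ.+ + r ℤ.+ + s
    cast₄ p q r s = trans (ℤ.pos-+ (p + q + r) s) (cong (ℤ._+ + s) (cast₃ p q r))
    cancel : ∀ (T D D′ N B B′ a b : ℤ) → T ℤ.+ T ℤ.+ D ℤ.+ D′ ≡ N ℤ.+ a ℤ.+ b →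
      T - ((B′ ℤ.+ b - B′) - D′) ≡ N - (T - ((B ℤ.+ a - B) - D))
    cancel T D D′ N B B′ a b eq = begin
      T - ((B′ ℤ.+ b - B′) - D′)               ≡⟨ difference T D D′ N B B′ a b ⟩
      R ℤ.+ ((T ℤ.+ T ℤ.+ D ℤ.+ D′) - Y)        ≡⟨ cong (λ x → R ℤ.+ (x - Y)) eq ⟩
      R ℤ.+ (Y - Y)                            ≡⟨ cong (λ x → R ℤ.+ x) (ℤ.+-inverseʳ Y) ⟩
      R ℤ.+ + 0                                ≡⟨ ℤ.+-identityʳ R ⟩
      R                                        ∎
      where
      R = N - (T - ((B ℤ.+ a - B) - D))
      Y = N ℤ.+ a ℤ.+ b
      difference : ∀ (T D D′ N B B′ a b : ℤ) →
        T - ((B′ ℤ.+ b - B′) - D′) ≡ (N - (T - ((B ℤ.+ a - B) - D))) ℤ.+ ((T ℤ.+ T ℤ.+ D ℤ.+ D′) - (N ℤ.+ a ℤ.+ b))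
      difference = ℤ-Solver.solve-∀

module ComplementFilling {n m : ℕ} {π₁ π₂ : ℕ → ℕ} (P₁ : IsPermOn 1 m π₁) (P₂ : IsPermOn (m + 1) n π₂)
                         {μ : ℕ → ℕ} {σ : Filling} (naf : IsNAF n μ (concatPerm m π₁ π₂) σ) where
  open ArmTriples n μ
  open Complement n m
  module Iσ = InversionTriples n μ σ

  f : Filling
  f = fMap n m π₁ π₂ σ

  module If = InversionTriples n μ f

  fMap-complement : ∀ {t} → 1 ≤ t → t ≤ n → ∀ k → f t k ≡ complement (σ t k)
  fMap-complement 1≤t t≤n zero =
    trans (complement-basement P₁ P₂ 1≤t t≤n) (cong complement (sym (proj₁ (proj₁ naf) _ 1≤t t≤n)))
  fMap-complement _ _ (suc k) = refl

  module _ (i a k : ℕ) (i<n : i < n) (a<n : a < n) (k<μ : k < μ (suc i)) where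
    private
      t s r : ℕ
      t = suc i
      s = suc a
      r = armRow t s k

    triple-local : AttacksBothEnds t s k →
      2 + 𝟙 (σ t k <ᵇ σ t (suc k)) + 𝟙 (f t k <ᵇ f t (suc k)) ≡
      𝟙 (not (σ t (suc k) ≡ᵇ σ t k)) + Iσ.tripleInversions t s k + If.tripleInversions t s k
    triple-local (w-hat , u-w , w-d)
      rewrite fMap-complement (s≤s z≤n) i<n k | fMap-complement (s≤s z≤n) a<n r =
      complement-triple (values _ u-hat) (values _ w-hat) (values _ d-hat)
                        (proj₂ naf _ _ u-hat w-hat u-w) (proj₂ naf _ _ w-hat d-hat w-d)
      where
      values = proj₂ (proj₁ naf)
      u-hat = inHat-intro n μ (s≤s z≤n) i<n k<μ
      d-hat = inHat-intro n μ (s≤s z≤n) i<n (<⇒≤ k<μ)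

    triple-identity :
      inArm t s k + inArm t s k + 𝟙 (σ t k <ᵇ σ t (suc k)) * inArm t s k + 𝟙 (f t k <ᵇ f t (suc k)) * inArm t s k ≡
      𝟙 (not (σ t (suc k) ≡ᵇ σ t k)) * inArm t s k + inArm t s k * Iσ.tripleInversions t s k + inArm t s k * If.tripleInversions t s k
    triple-identity = weighted-by-indicator (inArm t s k) (𝟙 (σ t k <ᵇ σ t (suc k))) (𝟙 (f t k <ᵇ f t (suc k)))
      (𝟙 (not (σ t (suc k) ≡ᵇ σ t k))) (Iσ.tripleInversions t s k) (If.tripleInversions t s k)
      (Sum.map₂ (Product.map₂ triple-local) (armTriple-cases t s k))

  arm-identity : totalArm n μ + totalArm n μ + descentArmSum n μ σ + descentArmSum n μ f ≡
    nonEqArmSum n μ σ + tripleSum (λ t s k → inArm t s k * Iσ.tripleInversions t s k)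
                      + tripleSum (λ t s k → inArm t s k * If.tripleInversions t s k)
  arm-identity = begin
    totalArm n μ + totalArm n μ + descentArmSum n μ σ + descentArmSum n μ f
      ≡⟨ cong₂ _+_ (cong₂ _+_ (cong₂ _+_ totalArm≡tripleSum totalArm≡tripleSum) (descentArmSum≡tripleSum σ))
                   (descentArmSum≡tripleSum f) ⟩
    tripleSum inArm + tripleSum inArm + tripleSum (weighted descσ) + tripleSum (weighted descf)
      ≡⟨ tripleSum-distrib-+₄ inArm inArm (weighted descσ) (weighted descf) ⟨
    tripleSum (λ t s k → inArm t s k + inArm t s k + weighted descσ t s k + weighted descf t s k)
      ≡⟨ tripleSum-cong (λ t s k → inArm t s k + inArm t s k + weighted descσ t s k + weighted descf t s k)
                        (λ t s k → weighted nonEq t s k + inversionsσ t s k + inversionsf t s k) triple-identity ⟩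
    tripleSum (λ t s k → weighted nonEq t s k + inversionsσ t s k + inversionsf t s k)
      ≡⟨ tripleSum-distrib-+₃ (weighted nonEq) inversionsσ inversionsf ⟩
    tripleSum (weighted nonEq) + tripleSum inversionsσ + tripleSum inversionsf
      ≡⟨ cong (λ e → e + tripleSum inversionsσ + tripleSum inversionsf) (nonEqArmSum≡tripleSum σ) ⟨
    nonEqArmSum n μ σ + tripleSum inversionsσ + tripleSum inversionsf
      ∎
    where
    descσ descf nonEq : ℕ → ℕ → Bool
    descσ t k = σ t k <ᵇ σ t (suc k)
    descf t k = f t k <ᵇ f t (suc k)
    nonEq t k = not (σ t (suc k) ≡ᵇ σ t k)
    weighted : (ℕ → ℕ → Bool) → ℕ → ℕ → ℕ → ℕ
    weighted p t s k = 𝟙 (p t k) * inArm t s k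
    inversionsσ inversionsf : ℕ → ℕ → ℕ → ℕ
    inversionsσ t s k = inArm t s k * Iσ.tripleInversions t s k
    inversionsf t s k = inArm t s k * If.tripleInversions t s k
    tripleSum-distrib-+₃ : ∀ F G H → tripleSum (λ t s k → F t s k + G t s k + H t s k) ≡ tripleSum F + tripleSum G + tripleSum H
    tripleSum-distrib-+₃ F G H =
      trans (tripleSum-distrib-+ (λ t s k → F t s k + G t s k) H) (cong (_+ tripleSum H) (tripleSum-distrib-+ F G))
    tripleSum-distrib-+₄ : ∀ F G H K →
      tripleSum (λ t s k → F t s k + G t s k + H t s k + K t s k) ≡ tripleSum F + tripleSum G + tripleSum H + tripleSum K
    tripleSum-distrib-+₄ F G H K =
      trans (tripleSum-distrib-+ (λ t s k → F t s k + G t s k + H t s k) K) (cong (_+ tripleSum K) (tripleSum-distrib-+₃ F G H))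

lemma3p14 : (n m : ℕ) → m < n →
    (π₁ π₂ : ℕ → ℕ) → IsPermOn 1 m π₁ → IsPermOn (m + 1) n π₂ →
    (μ : ℕ → ℕ) → (σ : Filling) → IsNAF n μ (concatPerm m π₁ π₂) σ →
    coinv n μ (concatPerm m (compl 1 m π₁) (compl (m + 1) n π₂)) (fMap n m π₁ π₂ σ)
    ≡ coinv' n μ (concatPerm m π₁ π₂) σ
lemma3p14 n m _ π₁ π₂ P₁ P₂ μ σ naf =
  coinv≡coinv'-byTriples n μ π πᶜ σ f
    (Iσ.invCount≡basement+triples π (proj₁ (proj₁ naf)))
    (If.invCount≡basement+triples πᶜ (λ _ _ _ → refl))
    arm-identity
  where
  open ComplementFilling P₁ P₂ naf
  π πᶜ : ℕ → ℕ
  π = concatPerm m π₁ π₂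
  πᶜ = concatPerm m (compl 1 m π₁) (compl (m + 1) n π₂)
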